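{- Let $T$ be a tableau and $x,y$ distinct elements not among the labels of $T$. Suppose the column trail of $x\to T$ and the row trail of $T\leftarrow y$ have a common box $S$ which is a box of $T$. Let $B$ (resp. $J$) be the box following $S$ in the column trail (resp. row trail), possibly the empty box of that trail, and let $A$ (resp. $I$) be the box preceding $S$ in the column trail (resp. row trail), when it exists. Then the set of those boxes among $A,B,I,J$ (that exist) which have a side in common with $S$ is one of the five sets $\{J,B\}$, $\{I,J,B\}$, $\{A,J,B\}$, $\{I,J\}$, $\{A,B\}$. (Here a box sharing a side with $S$ is necessarily: $A$ immediately to the left of $S$, $B$ immediately to the right, $I$ immediately below, $J$ immediately above.)
   Context: Tableaux use the French convention: a tableau $T$ is a finite lower order ideal $D$ (componentwise order) of boxes $(c,r)\in\{1,2,\dots\}^2$ ($c$ = column, $r$ = row, row $1$ at the bottom), with an injective labelling by a totally ordered set, strictly increasing to the right along rows and upward along columns. Row insertion of $x$ into a row $L$ ($x\notin L$): if $L$ is empty or $x>\max L$, append $x$; otherwise replace the smallest $z\in L$ with $z>x$ by $x$, and $z$ is bumped. $T\leftarrow x$ inserts $x$ into row $1$, then the bumped element into row $2$, etc., until nothing is bumped (the last element occupies a new box at the end of its row). Column insertion $x\to T$ is defined symmetrically with columns (column $1$ leftmost). The row trail of $T\leftarrow x$ is the sequence of boxes of $T$ whose labels are bumped, in order, followed by the newly created box (the empty box of the trail, not in $T$). The column trail of $x\to T$ is defined symmetrically. -}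

module Defs where

open import Level using (Level)
open import Data.Nat using (ℕ; zero; suc; _≤_; _∸_)
open import Data.Nat.Properties using ()
open import Data.Bool using (Bool; true; false)
open import Data.List using (List; []; _∷_; length; map; concat; mapMaybe; upTo)
open import Data.Maybe using (Maybe; just; nothing)
open import Data.Product using (Σ; _×_; _,_)
open import Data.Unit using (⊤)
open import Data.Empty using (⊥)
open import Relation.Nullary using (yes; no)
open import Relation.Binary using (Rel; IsStrictTotalOrder)
open import Relation.Binary.PropositionalEquality using (_≡_)
open import Data.List.Relation.Unary.All using (All)
open import Data.List.Relation.Unary.Linked using (Linked)
open import Data.List.Relation.Unary.Unique.Propositional using (Unique)

at : ∀ {a} {X : Set a} → List X → ℕ → Maybe X
at []       _       = nothing
at (z ∷ zs) zero    = just z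
at (z ∷ zs) (suc n) = at zs n

-- A box (c , r): c = column, r = row, both ≥ 1, row 1 at the bottom.
Box : Set
Box = ℕ × ℕ

data Adjacent : Box → Box → Set where
  left  : ∀ c r → Adjacent (c , r) (suc c , r)
  right : ∀ c r → Adjacent (suc c , r) (c , r)
  below : ∀ c r → Adjacent (c , r) (c , suc r)
  above : ∀ c r → Adjacent (c , suc r) (c , r)

AdjM : Maybe Box → Box → Set
AdjM nothing  S = ⊥
AdjM (just b) S = Adjacent b S

module Tab {a ℓ} {A : Set a} {_<_ : Rel A ℓ}
           (sto : IsStrictTotalOrder _≡_ _<_) where

  open IsStrictTotalOrder sto using (_<?_)

  -- A tableau (French convention) is represented by its list of rows,
  -- bottom row first; each row is the list of its labels from left to right.
  Rows : Set a
  Rows = List (List A)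

  NonEmpty : List A → Set
  NonEmpty []      = ⊥
  NonEmpty (_ ∷ _) = ⊤

  Above : List A → List A → Set ℓ
  Above []       _        = Level.Lift _ ⊤
  Above (u ∷ us) []       = Level.Lift _ ⊥
  Above (u ∷ us) (l ∷ ls) = (l < u) × Above us ls

  ColumnsIncreasing : Rows → Set ℓ
  ColumnsIncreasing []            = Level.Lift _ ⊤
  ColumnsIncreasing (l ∷ [])      = Level.Lift _ ⊤
  ColumnsIncreasing (l ∷ u ∷ rs)  = Above u l × ColumnsIncreasing (u ∷ rs)

  labels : Rows → List A
  labels = concat

  record IsTableau (T : Rows) : Set (a Level.⊔ ℓ) where
    field
      rowsNonEmpty     : All NonEmpty T
      rowsIncreasing   : All (Linked _<_) T
      colsIncreasing   : ColumnsIncreasing T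
      injective        : Unique (labels T)

  InT : Rows → Box → Set a
  InT T (c , r) = Σ (List A) λ L → (at T (r ∸ 1) ≡ just L) × (1 ≤ c) × (c ≤ length L) × (1 ≤ r)

  -- columns of T (column 1 first), each listed bottom to top
  columns : Rows → Rows
  columns [] = []
  columns (R ∷ Rs) = map (λ j → mapMaybe (λ L → at L j) (R ∷ Rs)) (upTo (length R))

  -- insertion of x into a line L: new line, bumped element (if any),
  -- 0-based position in L of the modified/created cell
  insLine : A → List A → List A × Maybe A × ℕ
  insLine x [] = (x ∷ [] , nothing , 0)
  insLine x (z ∷ zs) with x <? z
  ... | yes _ = (x ∷ zs , just z , 0)
  ... | no _  with insLine x zs
  ...   | (l , b , p) = (z ∷ l , b , suc p)

  -- trail of inserting x into successive lines, starting with line number i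
  -- (0-based); entries are (line index , position in line), 0-based.
  lineTrail : Rows → A → ℕ → List (ℕ × ℕ)
  lineTrail [] x i = (i , 0) ∷ []
  lineTrail (L ∷ Ls) x i with insLine x L
  ... | (_ , nothing , p) = (i , p) ∷ []
  ... | (_ , just z  , p) = (i , p) ∷ lineTrail Ls z (suc i)

  rowTrail : Rows → A → List Box
  rowTrail T y = map (λ { (i , p) → (suc p , suc i) }) (lineTrail T y 0)

  colTrail : A → Rows → List Box
  colTrail x T = map (λ { (i , p) → (suc i , suc p) }) (lineTrail (columns T) x 0)

  prev : List Box → ℕ → Maybe Box
  prev t zero    = nothing
  prev t (suc k) = at t k

{-# OPTIONS --safe #-}
-- The element u that the column trail inserts into the column
-- of S was bumped from the previous column, from a row weakly above that of S, since a column bump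
-- never moves up. If A is not adjacent that row is strictly higher, so all labels in the row above S
-- and left of S are smaller than the label s of S; hence s, bumped by the row trail, lands directly
-- above S: ¬ A → J. The transposed argument gives ¬ I → B. Finally A and I are never both adjacent:
-- the insertion of u passes the label v of I and the insertion of v passes u, so u = v in two
-- different rows. The five sets are exactly the adjacency patterns compatible with these three facts.
module Submission where

open import Defs

open import Level using (_⊔_; lift)
open import Data.Nat as ℕ using (ℕ; zero; suc; s≤s; _≟_)
open import Data.Nat.Properties using (+-identityʳ; +-suc; n<1+n; ≮⇒≥; ≤∧≢⇒<; m≤n⇒m<n∨m≡n; 1+n≢n; ≤-pred)
open import Data.List using (List; []; _∷_; _++_; length; map; concat; mapMaybe; applyUpTo; upTo)
open import Data.Maybe using (Maybe; just; nothing; fromMaybe)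
import Data.Maybe as Maybe
open import Data.Maybe.Properties using (just-injective)
open import Data.Product using (Σ; _×_; _,_; proj₂)
open import Data.Sum using (_⊎_; inj₁; inj₂)
open import Data.Empty using (⊥; ⊥-elim)
open import Relation.Nullary using (¬_; Dec; yes; no)
open import Relation.Nullary.Decidable using (map′; _×-dec_; _⊎-dec_)
open import Relation.Binary using (Rel; IsStrictTotalOrder; tri<; tri≈; tri>)
open import Relation.Binary.PropositionalEquality using (_≡_; refl; sym; trans; cong; subst)
open import Data.List.Relation.Unary.All using (All; []; _∷_)
import Data.List.Relation.Unary.All as All
open import Data.List.Relation.Unary.Linked using (Linked; []; _∷_)
open import Data.List.Relation.Unary.AllPairs using (_∷_)
open import Data.List.Relation.Unary.Unique.Propositional using (Unique)
open import Data.List.Membership.Propositional using (_∈_; _∉_)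
open import Data.List.Membership.Propositional.Properties using (∈-++⁺ˡ; ∈-++⁺ʳ)
open import Data.List.Relation.Unary.Any using (here; there)

AdjacentPositions : Box → Box → Set
AdjacentPositions (c , r) (c' , r') =
  (suc c ≡ c' × r ≡ r') ⊎ (c ≡ suc c' × r ≡ r') ⊎ (c ≡ c' × suc r ≡ r') ⊎ (c ≡ c' × r ≡ suc r')

adjacent⇒positions : ∀ {b S} → Adjacent b S → AdjacentPositions b S
adjacent⇒positions (left _ _)  = inj₁ (refl , refl)
adjacent⇒positions (right _ _) = inj₂ (inj₁ (refl , refl))
adjacent⇒positions (below _ _) = inj₂ (inj₂ (inj₁ (refl , refl)))
adjacent⇒positions (above _ _) = inj₂ (inj₂ (inj₂ (refl , refl)))

positions⇒adjacent : ∀ b S → AdjacentPositions b S → Adjacent b S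
positions⇒adjacent (c , r) _ (inj₁ (refl , refl))               = left c r
positions⇒adjacent (_ , r) (c , _) (inj₂ (inj₁ (refl , refl)))  = right c r
positions⇒adjacent (c , r) _ (inj₂ (inj₂ (inj₁ (refl , refl)))) = below c r
positions⇒adjacent (c , _) (_ , r) (inj₂ (inj₂ (inj₂ (refl , refl)))) = above c r

adjacent? : (b S : Box) → Dec (Adjacent b S)
adjacent? b@(c , r) S@(c' , r') = map′ (positions⇒adjacent b S) adjacent⇒positions
  ((suc c ≟ c' ×-dec r ≟ r') ⊎-dec (c ≟ suc c' ×-dec r ≟ r')
    ⊎-dec (c ≟ c' ×-dec suc r ≟ r') ⊎-dec (c ≟ c' ×-dec r ≟ suc r'))

adjacentM? : (mb : Maybe Box) (S : Box) → Dec (AdjM mb S)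
adjacentM? nothing  S = no λ ()
adjacentM? (just b) S = adjacent? b S

FiveSets : (A B I J : Set) → Set
FiveSets A B I J =
    (¬ A × B × ¬ I × J) ⊎ (¬ A × B × I × J) ⊎ (A × B × ¬ I × J)
  ⊎ (¬ A × ¬ B × I × J) ⊎ (A × B × ¬ I × ¬ J)

five-sets : ∀ {A B I J} → Dec A → Dec B → Dec I → Dec J →
  (¬ A → J) → (¬ I → B) → ¬ (A × I) → FiveSets A B I J
five-sets (no ¬a) _       (no ¬i) _       ¬a⇒j ¬i⇒b _ = inj₁ (¬a , ¬i⇒b ¬i , ¬i , ¬a⇒j ¬a)
five-sets (no ¬a) (yes b) (yes i) _       ¬a⇒j _    _ = inj₂ (inj₁ (¬a , b , i , ¬a⇒j ¬a))
five-sets (no ¬a) (no ¬b) (yes i) _       ¬a⇒j _    _ = inj₂ (inj₂ (inj₂ (inj₁ (¬a , ¬b , i , ¬a⇒j ¬a))))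
five-sets (yes a) _       (yes i) _       _    _    ¬ai = ⊥-elim (¬ai (a , i))
five-sets (yes a) _       (no ¬i) (yes j) _    ¬i⇒b _ = inj₂ (inj₂ (inj₁ (a , ¬i⇒b ¬i , ¬i , j)))
five-sets (yes a) _       (no ¬i) (no ¬j) _    ¬i⇒b _ = inj₂ (inj₂ (inj₂ (inj₂ (a , ¬i⇒b ¬i , ¬i , ¬j))))

at-map : ∀ {b c} {X : Set b} {Y : Set c} (f : X → Y) xs k → at (map f xs) k ≡ Maybe.map f (at xs k)
at-map f []       k       = refl
at-map f (x ∷ xs) zero    = refl
at-map f (x ∷ xs) (suc k) = at-map f xs k

at-applyUpTo : ∀ {b} {X : Set b} (f : ℕ → X) {n c} → c ℕ.< n → at (applyUpTo f n) c ≡ just (f c)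
at-applyUpTo f {suc n} {zero}  _         = refl
at-applyUpTo f {suc n} {suc c} (s≤s c<n) = at-applyUpTo (λ k → f (suc k)) c<n

at-applyUpTo-≥ : ∀ {b} {X : Set b} (f : ℕ → X) {n c} → n ℕ.≤ c → at (applyUpTo f n) c ≡ nothing
at-applyUpTo-≥ f {zero}           _         = refl
at-applyUpTo-≥ f {suc n} {suc c} (s≤s n≤c) = at-applyUpTo-≥ (λ k → f (suc k)) n≤c

at-≥length : ∀ {b} {X : Set b} (xs : List X) {c} → length xs ℕ.≤ c → at xs c ≡ nothing
at-≥length []       _         = refl
at-≥length (x ∷ xs) (s≤s len≤c) = at-≥length xs len≤c

at-<length : ∀ {b} {X : Set b} (xs : List X) {c} → c ℕ.< length xs → Σ X λ x → at xs c ≡ just x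
at-<length (x ∷ xs) {zero}  _         = x , refl
at-<length (x ∷ xs) {suc c} (s≤s c<n) = at-<length xs c<n

at-∈ : ∀ {b} {X : Set b} (xs : List X) {c x} → at xs c ≡ just x → x ∈ xs
at-∈ (x ∷ xs) {zero}  refl = here refl
at-∈ (x ∷ xs) {suc c} eq   = there (at-∈ xs eq)

colBox : ℕ × ℕ → Box
colBox (c , r) = (suc c , suc r)

rowBox : ℕ × ℕ → Box
rowBox (r , c) = (suc c , suc r)

-- β draws a trail entry (line , position) as a box; consecutive lines at one position lie side by side.
record Orientation (β : ℕ × ℕ → Box) : Set where
  field
    prev-adjacent  : ∀ l p → Adjacent (β (l , p)) (β (suc l , p))
    prev-adjacent⁻ : ∀ {l p q} → Adjacent (β (l , q)) (β (suc l , p)) → q ≡ p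
    next-adjacent  : ∀ l p → Adjacent (β (suc l , p)) (β (l , p))

colBox-orientation : Orientation colBox
colBox-orientation = record
  { prev-adjacent  = λ l p → left (suc l) (suc p)
  ; prev-adjacent⁻ = λ { (left _ _) → refl }
  ; next-adjacent  = λ l p → right (suc l) (suc p) }

rowBox-orientation : Orientation rowBox
rowBox-orientation = record
  { prev-adjacent  = λ l p → below (suc p) (suc l)
  ; prev-adjacent⁻ = λ { (below _ _) → refl }
  ; next-adjacent  = λ l p → above (suc p) (suc l) }

module TableauInsertion {a ℓ} {A : Set a} {_<_ : Rel A ℓ} (sto : IsStrictTotalOrder _≡_ _<_) where
  open Tab sto
  open IsStrictTotalOrder sto using (_<?_; compare; asym) renaming (trans to <-trans)

  Line : Set a
  Line = ℕ → Maybe A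

  Grid : Set a
  Grid = ℕ → Line

  transpose : Grid → Grid
  transpose h l p = h p l

  -- Phrased with ¬ (e < w) rather than w < e, so that e need not be absent from the line.
  record InsertsAt (e : A) (line : Line) (p : ℕ) : Set (a ⊔ ℓ) where
    field
      passes : ∀ {q} → q ℕ.< p → Σ A λ w → line q ≡ just w × ¬ (e < w)
      stops  : ∀ {z} → line p ≡ just z → e < z
  open InsertsAt

  insertsAt-unique : ∀ {e line p p'} → InsertsAt e line p → InsertsAt e line p' → p ≡ p'
  insertsAt-unique {p = p} {p'} ins ins' with ℕ.<-cmp p p'
  ... | tri≈ _ p≡p' _ = p≡p'
  ... | tri< p<p' _ _ = let (w , hw , e≮w) = passes ins' p<p' in ⊥-elim (e≮w (stops ins hw))
  ... | tri> _ _ p'<p = let (w , hw , e≮w) = passes ins p'<p in ⊥-elim (e≮w (stops ins' hw))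

  insertsAt-cong : ∀ {e line line' p} → (∀ q → line q ≡ line' q) → InsertsAt e line p → InsertsAt e line' p
  insertsAt-cong {p = p} line≗line' ins = record
    { passes = λ {q} q<p → let (w , hw , e≮w) = passes ins q<p in w , trans (sym (line≗line' q)) hw , e≮w
    ; stops  = λ hz → stops ins (trans (line≗line' p) hz) }

  insLine-insertsAt : ∀ x L → let (_ , bumped , p) = insLine x L in InsertsAt x (at L) p × bumped ≡ at L p
  insLine-insertsAt x [] = record { passes = λ () ; stops = λ () } , refl
  insLine-insertsAt x (z ∷ zs) with x <? z
  ... | yes x<z = record { passes = λ () ; stops = λ { refl → x<z } } , refl
  ... | no x≮z with insLine x zs | insLine-insertsAt x zs
  ...   | (_ , _ , p) | (ins , bumped≡) = record
          { passes = λ { {zero} _ → z , refl , x≮z ; {suc q} (s≤s q<p) → passes ins q<p }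
          ; stops  = stops ins } , bumped≡

  lineAt : Rows → ℕ → List A
  lineAt Ls l = fromMaybe [] (at Ls l)

  -- cell T r c is the label in row r and column c (0-based); its transpose is the grid of columns.
  cell : Rows → Grid
  cell Ls l p = at (lineAt Ls l) p

  trail-index : ∀ Ls x i j {l p} → at (lineTrail Ls x i) j ≡ just (l , p) → l ≡ i ℕ.+ j
  trail-index []       x i zero    refl = sym (+-identityʳ i)
  trail-index []       x i (suc j) ()
  trail-index (L ∷ Ls) x i j eq with insLine x L
  trail-index (L ∷ Ls) x i zero    refl | (_ , nothing , _) = sym (+-identityʳ i)
  trail-index (L ∷ Ls) x i (suc j) ()   | (_ , nothing , _)
  trail-index (L ∷ Ls) x i zero    refl | (_ , just _ , _)  = sym (+-identityʳ i)
  trail-index (L ∷ Ls) x i (suc j) eq   | (_ , just z , _)  =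
    trans (trail-index Ls z (suc i) j eq) (sym (+-suc i j))

  trail-head : ∀ Ls x i → Σ ℕ λ p → at (lineTrail Ls x i) 0 ≡ just (i , p) × InsertsAt x (cell Ls 0) p
  trail-head []       x i = 0 , refl , record { passes = λ () ; stops = λ () }
  trail-head (L ∷ Ls) x i with insLine x L | insLine-insertsAt x L
  ... | (_ , nothing , p) | (ins , _) = p , refl , ins
  ... | (_ , just _  , p) | (ins , _) = p , refl , ins

  trail-next : ∀ Ls x i j {l p z} → at (lineTrail Ls x i) j ≡ just (l , p) → cell Ls j p ≡ just z →
    Σ ℕ λ p' → at (lineTrail Ls x i) (suc j) ≡ just (suc l , p') × InsertsAt z (cell Ls (suc j)) p'
  trail-next []       x i zero    refl ()
  trail-next []       x i (suc j) ()   _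
  trail-next (L ∷ Ls) x i j eq hz with insLine x L | insLine-insertsAt x L
  trail-next (L ∷ Ls) x i zero    refl hz | (_ , nothing , _) | (_ , bumped≡) with trans bumped≡ hz
  ... | ()
  trail-next (L ∷ Ls) x i (suc j) ()   hz | (_ , nothing , _) | _
  trail-next (L ∷ Ls) x i zero    refl hz | (_ , just z , _) | (_ , bumped≡) with trans bumped≡ hz
  ... | refl = trail-head Ls z (suc i)
  trail-next (L ∷ Ls) x i (suc j) eq   hz | (_ , just z , _) | _ = trail-next Ls z (suc i) j eq hz

  trail-prev : ∀ Ls x i j {l p} → at (lineTrail Ls x i) (suc j) ≡ just (l , p) →
    Σ ℕ λ l' → Σ ℕ λ p' → Σ A λ z →
      at (lineTrail Ls x i) j ≡ just (l' , p') × cell Ls j p' ≡ just z × InsertsAt z (cell Ls (suc j)) p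
  trail-prev []       x i j ()
  trail-prev (L ∷ Ls) x i j eq with insLine x L | insLine-insertsAt x L
  trail-prev (L ∷ Ls) x i j       () | (_ , nothing , _) | _
  trail-prev (L ∷ Ls) x i zero    eq | (_ , just z , p) | (_ , bumped≡) with trail-head Ls z (suc i)
  ... | (_ , e , ins) with trans (sym e) eq
  ...   | refl = i , p , z , refl , sym bumped≡ , ins
  trail-prev (L ∷ Ls) x i (suc j) eq | (_ , just z , _) | _ = trail-prev Ls z (suc i) j eq

  data Source (β : ℕ × ℕ → Box) (h : Grid) (e : A) : ℕ → Maybe Box → Set a where
    initial : Source β h e 0 nothing
    bumped  : ∀ {l p} → h l p ≡ just e → Source β h e (suc l) (just (β (l , p)))

  -- A trail through the lines of h passes (l , p); pre and next are the boxes A and B, or I and J.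
  record Visit (β : ℕ × ℕ → Box) (h : Grid) (l p : ℕ) (pre next : Maybe Box) : Set (a ⊔ ℓ) where
    field
      entering : A
      lands    : InsertsAt entering (h l) p
      source   : Source β h entering l pre
      onward   : ∀ {s} → h l p ≡ just s → Σ ℕ λ p' → InsertsAt s (h (suc l)) p' × next ≡ just (β (suc l , p'))
  open Visit

  module _ (β : ℕ × ℕ → Box) (Ls : Rows) {h : Grid} (x : A) (cells : ∀ l p → cell Ls l p ≡ h l p) where

    trail-arrival : ∀ k {p} → at (lineTrail Ls x 0) k ≡ just (k , p) →
      Σ A λ u → InsertsAt u (h k) p × Source β h u k (prev (map β (lineTrail Ls x 0)) k)
    trail-arrival zero e with trail-head Ls x 0
    ... | (_ , e' , ins) with trans (sym e) e'
    ...   | refl = x , insertsAt-cong (cells 0) ins , initial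
    trail-arrival (suc j) e with trail-prev Ls x 0 j e
    ... | (l' , p' , z , e' , hz , ins) with trail-index Ls x 0 j e'
    ...   | refl = z , insertsAt-cong (cells (suc j)) ins ,
                   subst (Source β h z (suc j)) (sym (trans (at-map β (lineTrail Ls x 0) j) (cong (Maybe.map β) e')))
                         (bumped (trans (sym (cells j p')) hz))

    trail-onward : ∀ k {p s} → at (lineTrail Ls x 0) k ≡ just (k , p) → h k p ≡ just s →
      Σ ℕ λ p' → InsertsAt s (h (suc k)) p' × at (map β (lineTrail Ls x 0)) (suc k) ≡ just (β (suc k , p'))
    trail-onward k {p} e hs with trail-next Ls x 0 k e (trans (cells k p) hs)
    ... | (p' , e' , ins) = p' , insertsAt-cong (cells (suc k)) ins , trans (at-map β (lineTrail Ls x 0) (suc k)) (cong (Maybe.map β) e')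

    trail-visit : ∀ {k S} → at (map β (lineTrail Ls x 0)) k ≡ just S →
      Σ ℕ λ p → S ≡ β (k , p) × Visit β h k p (prev (map β (lineTrail Ls x 0)) k) (at (map β (lineTrail Ls x 0)) (suc k))
    trail-visit {k} hk with at (lineTrail Ls x 0) k in e | trans (sym (at-map β (lineTrail Ls x 0) k)) hk
    ... | just (l , p) | refl with trail-index Ls x 0 k e
    ...   | refl = let (u , ins , src) = trail-arrival k e in
                   p , refl , record { entering = u ; lands = ins ; source = src ; onward = trail-onward k e }

  -- The smaller neighbour must exist, so the occupied cells form a lower set.
  record IsTableauGrid (h : Grid) : Set (a ⊔ ℓ) where
    field
      along  : ∀ {l p b} → h l (suc p) ≡ just b → Σ A λ a' → h l p ≡ just a' × a' < b
      across : ∀ {l p b} → h (suc l) p ≡ just b → Σ A λ a' → h l p ≡ just a' × a' < b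
  open IsTableauGrid

  transpose-isTableauGrid : ∀ {h} → IsTableauGrid h → IsTableauGrid (transpose h)
  transpose-isTableauGrid G = record { along = across G ; across = along G }

  along-< : ∀ {h} → IsTableauGrid h → ∀ {l p q b} → h l p ≡ just b → q ℕ.< p → Σ A λ a' → h l q ≡ just a' × a' < b
  along-< G {p = suc p} hb (s≤s q≤p) with along G hb | m≤n⇒m<n∨m≡n q≤p
  ... | (a' , ha' , a'<b) | inj₂ refl = a' , ha' , a'<b
  ... | (a' , ha' , a'<b) | inj₁ q<p  = let (a'' , ha'' , a''<a') = along-< G ha' q<p in a'' , ha'' , <-trans a''<a' a'<b

  across-< : ∀ {h} → IsTableauGrid h → ∀ {l p q b} → h l p ≡ just b → q ℕ.< l → Σ A λ a' → h q p ≡ just a' × a' < b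
  across-< G = along-< (transpose-isTableauGrid G)

  along-suc-< : ∀ {h} → IsTableauGrid h → ∀ {l p s z} → h l p ≡ just s → h l (suc p) ≡ just z → s < z
  along-suc-< G hs hz = let (s' , hs' , s'<z) = along G hz in subst (_< _) (just-injective (trans (sym hs') hs)) s'<z

  bump-position-≤ : ∀ {h} → IsTableauGrid h → ∀ {l p p' u} → h l p' ≡ just u → InsertsAt u (h (suc l)) p → p ℕ.≤ p'
  bump-position-≤ G hu ins = ≮⇒≥ λ p'<p →
    let (w , hw , u≮w) = passes ins p'<p
    in u≮w (along-suc-< (transpose-isTableauGrid G) hu hw)

  straight-across : ∀ {β h c r s u m} → Orientation β → IsTableauGrid h → h c r ≡ just s →
    InsertsAt u (h c) r → Source β h u c m → ¬ AdjM m (β (c , r)) → InsertsAt s (transpose h (suc r)) c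
  straight-across O G hs ins initial _ = record { passes = λ () ; stops = along-suc-< G hs }
  straight-across {h = h} {suc c} {r} {s} {u} O G hs ins (bumped {p = r'} hu) ¬adj =
    record { passes = passes-left ; stops = along-suc-< G hs }
    where
    r<r' : r ℕ.< r'
    r<r' = ≤∧≢⇒< (bump-position-≤ G hu ins) λ { refl → ¬adj (Orientation.prev-adjacent O c r) }
    left-above : Σ A λ w → h c (suc r) ≡ just w × w < s
    left-above with m≤n⇒m<n∨m≡n r<r'
    ... | inj₂ r+1≡r' = u , subst (λ q → h c q ≡ just u) (sym r+1≡r') hu , stops ins hs
    ... | inj₁ r+1<r' = let (w , hw , w<u) = along-< G hu r+1<r' in w , hw , <-trans w<u (stops ins hs)
    passes-left : ∀ {q} → q ℕ.< suc c → Σ A λ w → h q (suc r) ≡ just w × ¬ (s < w)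
    passes-left q<c with left-above | m≤n⇒m<n∨m≡n (≤-pred q<c)
    ... | (w , hw , w<s) | inj₂ refl = w , hw , asym w<s
    ... | (w , hw , w<s) | inj₁ q<c' = let (w' , hw' , w'<w) = across-< G hw q<c' in w' , hw' , asym (<-trans w'<w w<s)

  continues-straight : ∀ {β h l p s pre next} → Orientation β → Visit β h l p pre next → h l p ≡ just s →
    InsertsAt s (h (suc l)) p → AdjM next (β (l , p))
  continues-straight {l = l} {p} O V hs ins with onward V hs
  ... | (p' , ins' , refl) with insertsAt-unique ins ins'
  ...   | refl = Orientation.next-adjacent O l p

  source-beside : ∀ {β h u c p m} → Orientation β → Source β h u c m → AdjM m (β (c , p)) →
    Σ ℕ λ c' → c ≡ suc c' × h c' p ≡ just u
  source-beside O (bumped hu) adj with Orientation.prev-adjacent⁻ O adj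
  ... | refl = _ , refl , hu

  LabelDeterminesPosition : Grid → Set a
  LabelDeterminesPosition h = ∀ {l l' p p' e} → h l p ≡ just e → h l' p' ≡ just e → p ≡ p'

  not-left-and-below : ∀ {h c r u v} → LabelDeterminesPosition h →
    h c (suc r) ≡ just u → InsertsAt u (h (suc c)) (suc r) →
    h (suc c) r ≡ just v → InsertsAt v (transpose h (suc r)) (suc c) → ⊥
  not-left-and-below {c = c} {r} {u} {v} same-position hu insu hv insv
    with passes insu (n<1+n r) | passes insv (n<1+n c)
  ... | (w , hw , u≮w) | (w' , hw' , v≮w') with trans (sym hv) hw | trans (sym hu) hw'
  ...   | refl | refl with compare u v
  ...     | tri< u<v _ _ = u≮w u<v
  ...     | tri> _ _ v<u = v≮w' v<u
  ...     | tri≈ _ refl _ = 1+n≢n (same-position hu hv)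

  not-beside-both : ∀ {h c r mA mB mI mJ} → LabelDeterminesPosition h →
    Visit colBox h c r mA mB → Visit rowBox (transpose h) r c mI mJ →
    AdjM mA (colBox (c , r)) → AdjM mI (colBox (c , r)) → ⊥
  not-beside-both {h} same-position V W adjA adjI
    with source-beside colBox-orientation (source V) adjA | source-beside rowBox-orientation (source W) adjI
  ... | (_ , refl , hu) | (_ , refl , hv) = not-left-and-below {h} same-position hu (lands V) hv (lands W)

  crossing-fiveSets : ∀ {h c r s mA mB mI mJ} → IsTableauGrid h →
    LabelDeterminesPosition h → h c r ≡ just s →
    Visit colBox h c r mA mB → Visit rowBox (transpose h) r c mI mJ →
    let S = colBox (c , r) in FiveSets (AdjM mA S) (AdjM mB S) (AdjM mI S) (AdjM mJ S)
  crossing-fiveSets {h} {c} {r} {s} {mA} {mB} {mI} {mJ} G same-position hs V W =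
    five-sets (adjacentM? mA S) (adjacentM? mB S) (adjacentM? mI S) (adjacentM? mJ S) ¬A⇒J ¬I⇒B ¬A×I
    where
    S : Box
    S = colBox (c , r)
    ¬A⇒J : ¬ AdjM mA S → AdjM mJ S
    ¬A⇒J ¬A = continues-straight rowBox-orientation W hs
      (straight-across colBox-orientation G hs (lands V) (source V) ¬A)
    ¬I⇒B : ¬ AdjM mI S → AdjM mB S
    ¬I⇒B ¬I = continues-straight colBox-orientation V hs
      (straight-across rowBox-orientation (transpose-isTableauGrid G) hs (lands W) (source W) ¬I)
    ¬A×I : ¬ (AdjM mA S × AdjM mI S)
    ¬A×I (adjA , adjI) = not-beside-both same-position V W adjA adjI

  lineAt-all : ∀ {p} {P : List A → Set p} {Ls} → All P Ls → P [] → ∀ l → P (lineAt Ls l)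
  lineAt-all []       P[] l       = P[]
  lineAt-all (pL ∷ _) P[] zero    = pL
  lineAt-all (_ ∷ pLs) P[] (suc l) = lineAt-all pLs P[] l

  lineAt-above : ∀ {Ls} → ColumnsIncreasing Ls → ∀ l → Above (lineAt Ls (suc l)) (lineAt Ls l)
  lineAt-above {[]}         _        l       = lift _
  lineAt-above {_ ∷ []}     _        zero    = lift _
  lineAt-above {_ ∷ []}     _        (suc l) = lift _
  lineAt-above {_ ∷ _ ∷ _}  (ab , _) zero    = ab
  lineAt-above {_ ∷ _ ∷ _}  (_ , ci) (suc l) = lineAt-above ci l

  linked-at : ∀ {L c b} → Linked _<_ L → at L (suc c) ≡ just b → Σ A λ a' → at L c ≡ just a' × a' < b
  linked-at {[]}            _           ()
  linked-at {_ ∷ []}        _           ()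
  linked-at {x ∷ _ ∷ _} {zero}  (x<y ∷ _)   refl = x , refl , x<y
  linked-at {_ ∷ _ ∷ _} {suc c} (_ ∷ link) eq   = linked-at link eq

  above-at : ∀ {u l c b} → Above u l → at u c ≡ just b → Σ A λ a' → at l c ≡ just a' × a' < b
  above-at {[]}             _            ()
  above-at {_ ∷ _} {[]}     (lift ())    _
  above-at {_ ∷ _} {l ∷ _} {zero}  (l<u , _) refl = l , refl , l<u
  above-at {_ ∷ _} {_ ∷ _} {suc c} (_ , ab)  eq   = above-at ab eq

  cell-isTableauGrid : ∀ {T} → IsTableau T → IsTableauGrid (cell T)
  cell-isTableauGrid tab = record
    { along  = λ {l} → linked-at (lineAt-all (IsTableau.rowsIncreasing tab) [] l)
    ; across = λ {l} → above-at (lineAt-above (IsTableau.colsIncreasing tab) l) }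

  absent-across : ∀ {h p} → IsTableauGrid h → h 0 p ≡ nothing → ∀ l → h l p ≡ nothing
  absent-across G h0 zero = h0
  absent-across {h} {p} G h0 (suc l) with h (suc l) p in e
  ... | nothing = refl
  ... | just _ with across G e
  ...   | (_ , hl , _) with trans (sym (absent-across G h0 l)) hl
  ...     | ()

  drop-line : ∀ {h} → IsTableauGrid h → IsTableauGrid (λ l → h (suc l))
  drop-line G = record { along = along G ; across = across G }

  mapMaybe-absent : ∀ Ls c → (∀ l → at (lineAt Ls l) c ≡ nothing) → mapMaybe (λ L → at L c) Ls ≡ []
  mapMaybe-absent []       c _      = refl
  mapMaybe-absent (L ∷ Ls) c absent rewrite absent 0 = mapMaybe-absent Ls c (λ l → absent (suc l))

  column-entries : ∀ Ls → IsTableauGrid (cell Ls) → ∀ c r → at (mapMaybe (λ L → at L c) Ls) r ≡ cell Ls r c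
  column-entries []       G c r = refl
  column-entries (L ∷ Ls) G c r with at L c in e
  column-entries (L ∷ Ls) G c zero    | just _ = sym e
  column-entries (L ∷ Ls) G c (suc r) | just _ = column-entries Ls (drop-line G) c r
  ... | nothing rewrite mapMaybe-absent Ls c (λ l → absent-across G e (suc l)) = sym (absent-across G e r)

  columns-cell : ∀ {T} → IsTableau T → ∀ c r → cell (columns T) c r ≡ cell T r c
  columns-cell {[]}     tab c r = refl
  columns-cell {R ∷ Rs} tab c r =
    trans (cong (λ m → at (fromMaybe [] m) r) (at-map column (upTo (length R)) c)) column-cell
    where
    G : IsTableauGrid (cell (R ∷ Rs))
    G = cell-isTableauGrid tab
    column : ℕ → List A
    column j = mapMaybe (λ L → at L j) (R ∷ Rs)
    column-at : Maybe ℕ → Maybe A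
    column-at m = at (fromMaybe [] (Maybe.map column m)) r
    column-cell : column-at (at (upTo (length R)) c) ≡ cell (R ∷ Rs) r c
    column-cell with c ℕ.<? length R
    ... | yes c<n = trans (cong column-at (at-applyUpTo (λ j → j) c<n)) (column-entries (R ∷ Rs) G c r)
    ... | no c≮n  = trans (cong column-at (at-applyUpTo-≥ (λ j → j) (≮⇒≥ c≮n)))
                          (sym (absent-across G (at-≥length R (≮⇒≥ c≮n)) r))

  cell-of-InT : ∀ T {c r} → InT T (suc c , suc r) → Σ A λ s → cell T r c ≡ just s
  cell-of-InT T {c} (L , eL , _ , c<len , _) =
    subst (λ m → Σ A λ s → at (fromMaybe [] m) c ≡ just s) (sym eL) (at-<length L c<len)

  unique-++-disjoint : ∀ (xs : List A) {ys e} → Unique (xs ++ ys) → e ∈ xs → e ∈ ys → ⊥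
  unique-++-disjoint (x ∷ xs) (x∉ ∷ _) (here refl) e∈ys = All.lookup x∉ (∈-++⁺ʳ xs e∈ys) refl
  unique-++-disjoint (x ∷ xs) (_ ∷ u)  (there e∈xs) e∈ys = unique-++-disjoint xs u e∈xs e∈ys

  unique-++ʳ : ∀ (xs : List A) {ys} → Unique (xs ++ ys) → Unique ys
  unique-++ʳ []       u       = u
  unique-++ʳ (x ∷ xs) (_ ∷ u) = unique-++ʳ xs u

  lineAt-∈-concat : ∀ Ls l {e} → e ∈ lineAt Ls l → e ∈ concat Ls
  lineAt-∈-concat []       l       ()
  lineAt-∈-concat (L ∷ Ls) zero    e∈L = ∈-++⁺ˡ e∈L
  lineAt-∈-concat (L ∷ Ls) (suc l) e∈  = ∈-++⁺ʳ L (lineAt-∈-concat Ls l e∈)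

  label-row-unique : ∀ Ls → Unique (concat Ls) → ∀ {r r' c c' e} → cell Ls r c ≡ just e → cell Ls r' c' ≡ just e → r ≡ r'
  label-row-unique []       _ ()
  label-row-unique (L ∷ Ls) u {zero}  {zero}   _  _   = refl
  label-row-unique (L ∷ Ls) u {zero}  {suc r'} he he' =
    ⊥-elim (unique-++-disjoint L u (at-∈ L he) (lineAt-∈-concat Ls r' (at-∈ (lineAt Ls r') he')))
  label-row-unique (L ∷ Ls) u {suc r} {zero}   he he' =
    ⊥-elim (unique-++-disjoint L u (at-∈ L he') (lineAt-∈-concat Ls r (at-∈ (lineAt Ls r) he)))
  label-row-unique (L ∷ Ls) u {suc r} {suc r'} he he' = cong suc (label-row-unique Ls (unique-++ʳ L u) he he')

open TableauInsertion using (trail-visit; columns-cell; crossing-fiveSets; transpose-isTableauGrid; cell-isTableauGrid; label-row-unique; cell-of-InT)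

corollary7 : ∀ {a ℓ} {A : Set a} {_<_ : Rel A ℓ} (sto : IsStrictTotalOrder _≡_ _<_) →
  let open Tab sto in
  (T : Rows) → IsTableau T → (x y : A) → x ∉ labels T → y ∉ labels T → ¬ (x ≡ y) →
  (S : Box) → InT T S →
  (k m : ℕ) → at (colTrail x T) k ≡ just S → at (rowTrail T y) m ≡ just S →
  let adjA = AdjM (prev (colTrail x T) k) S
      adjB = AdjM (at (colTrail x T) (suc k)) S
      adjI = AdjM (prev (rowTrail T y) m) S
      adjJ = AdjM (at (rowTrail T y) (suc m)) S
  in
    -- {J , B}
    (¬ adjA × adjB × ¬ adjI × adjJ)
    -- {I , J , B}
    ⊎ (¬ adjA × adjB × adjI × adjJ)
    -- {A , J , B}
    ⊎ (adjA × adjB × ¬ adjI × adjJ)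
    -- {I , J}
    ⊎ (¬ adjA × ¬ adjB × adjI × adjJ)
    -- {A , B}
    ⊎ (adjA × adjB × ¬ adjI × ¬ adjJ)
corollary7 sto T tab x y _ _ _ S inT k m hk hm
  with trail-visit sto colBox (Tab.columns sto T) x (columns-cell sto tab) hk
     | trail-visit sto rowBox T y (λ _ _ → refl) hm
... | _ , refl , V | _ , refl , W =
  crossing-fiveSets sto (transpose-isTableauGrid sto (cell-isTableauGrid sto tab))
    (label-row-unique sto T (Tab.IsTableau.injective tab)) (proj₂ (cell-of-InT sto T inT)) V W
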